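{- For any positive integers $m,n$, every maximal $312$-avoiding $m\times n$ $(0,1)$-matrix contains the same number of $1$'s.
   Context: An $m\times n$ $(0,1)$-matrix $A=[a_{ij}]$ is $312$-avoiding if there do not exist rows $i_1<i_2<i_3$ and columns $j_1<j_2<j_3$ with $a_{i_1j_3}=a_{i_2j_1}=a_{i_3j_2}=1$. $A$ is maximal $312$-avoiding if it is $312$-avoiding and every matrix obtained from $A$ by replacing a $0$ with a $1$ is not $312$-avoiding. -}

module Defs where

open import Data.Nat using (ℕ; suc; _+_)
open import Data.Bool using (Bool; true; false; _∧_; _∨_; if_then_else_)
open import Data.Fin using (Fin; _<_; _≟_)
open import Data.Product using (Σ; ∃; _×_; _,_)
open import Data.Vec.Functional using (foldr)
open import Relation.Binary.PropositionalEquality using (_≡_)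
open import Relation.Nullary using (¬_)
open import Relation.Nullary.Decidable using (⌊_⌋)

-- An m × n (0,1)-matrix: entry (i , j) is true iff a_{ij} = 1.
Matrix : ℕ → ℕ → Set
Matrix m n = Fin m → Fin n → Bool

Contains312 : ∀ {m n} → Matrix m n → Set
Contains312 {m} {n} A =
  Σ (Fin m) λ i₁ → Σ (Fin m) λ i₂ → Σ (Fin m) λ i₃ →
  Σ (Fin n) λ j₁ → Σ (Fin n) λ j₂ → Σ (Fin n) λ j₃ →
  (i₁ < i₂) × (i₂ < i₃) × (j₁ < j₂) × (j₂ < j₃) ×
  (A i₁ j₃ ≡ true) × (A i₂ j₁ ≡ true) × (A i₃ j₂ ≡ true)

Avoids312 : ∀ {m n} → Matrix m n → Set
Avoids312 A = ¬ Contains312 A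

setOne : ∀ {m n} → Matrix m n → Fin m → Fin n → Matrix m n
setOne A i j k l = (⌊ k ≟ i ⌋ ∧ ⌊ l ≟ j ⌋) ∨ A k l

MaximalAvoids312 : ∀ {m n} → Matrix m n → Set
MaximalAvoids312 {m} {n} A =
  Avoids312 A ×
  ((i : Fin m) (j : Fin n) → A i j ≡ false → ¬ Avoids312 (setOne A i j))

countOnes : ∀ {m n} → Matrix m n → ℕ
countOnes {m} {n} A =
  foldr _+_ 0 (λ i → foldr _+_ 0 (λ j → if A i j then 1 else 0))

module Submission where

-- One-row and one-column matrices have no room for a 312, so a maximal one
-- is all 1's.  Otherwise let A be maximal with m, n ≥ 2.  Call a 1 of A
-- inner if its row has further 1's on both sides of it.  Maximality forces
-- enough 1's that (i) every row contains at least two 1's, so each row has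
-- exactly two non-inner 1's (its leftmost and rightmost), and (ii) every
-- column strictly between the first and the last contains exactly two
-- inner 1's, while the boundary columns contain none.  Counting the 1's by
-- rows and the inner 1's by columns gives 2m + 2(n − 2) for every A.

open import Defs
open import Data.Bool using (Bool; true; false; if_then_else_)
open import Data.Bool.Properties using () renaming (_≟_ to _≟ᵇ_)
open import Data.Empty using (⊥; ⊥-elim)
open import Data.Fin using (Fin; zero; suc; toℕ; fromℕ; inject₁; _<_; _≤_)
open import Data.Fin.Properties using (_≟_; _<?_; any?; ≤∧≢⇒<; <⇒≢; ≤fromℕ; toℕ-fromℕ; toℕ-inject₁; toℕ<n; inject₁ℕ<)
open import Data.Nat as ℕ using (ℕ; suc; _+_; _*_; _≥_; s≤s; z≤n; s<s; z<s)
open import Data.Nat.Properties using (+-0-commutativeMonoid; ≮⇒≥; <⇒≱; ≤-<-trans; <-≤-trans; <-trans; <-irrefl; *-identityʳ; +-identityʳ; n<1+n)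
open import Data.Product using (Σ; ∃; _×_; _,_; proj₁; proj₂)
open import Data.Sum using (_⊎_; inj₁; inj₂)
open import Function using (_∘_)
open import Relation.Binary.PropositionalEquality
open import Relation.Nullary using (Dec; does; yes; no; ¬_; ¬?)
open import Relation.Nullary.Decidable using (dec-true; dec-false; _×-dec_)
open import Relation.Unary using (Decidable)
open import Algebra.Properties.CommutativeMonoid.Sum +-0-commutativeMonoid
  using (sum; sum-cong-≗; ∑-distrib-+; ∑-comm; sum-replicate-zero; sum-init-last)

open ≡-Reasoning

-- The 0/1 value of a Boolean; countOnes A is definitionally the double
-- sum of bit (A i j).
bit : Bool → ℕ
bit b = if b then 1 else 0

𝟙 : ∀ {p} {P : Set p} → Dec P → ℕ
𝟙 P? = bit (does P?)

𝟙-yes : ∀ {p} {P : Set p} (P? : Dec P) → P → 𝟙 P? ≡ 1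
𝟙-yes P? p = cong bit (dec-true P? p)

𝟙-no : ∀ {p} {P : Set p} (P? : Dec P) → ¬ P → 𝟙 P? ≡ 0
𝟙-no P? ¬p = cong bit (dec-false P? ¬p)

bit-split : ∀ b {q} {Q : Set q} (Q? : Dec Q) →
  bit b ≡ 𝟙 ((b ≟ᵇ true) ×-dec Q?) + 𝟙 ((b ≟ᵇ true) ×-dec ¬? Q?)
bit-split true  (yes _) = refl
bit-split true  (no _)  = refl
bit-split false _       = refl

δ : ∀ {k} → Fin k → Fin k → ℕ
δ a j = 𝟙 (j ≟ a)

sum-δ : ∀ {k} (a : Fin k) → sum (δ a) ≡ 1
sum-δ {suc k} zero    = cong suc (sum-replicate-zero k)
sum-δ {suc k} (suc a) = sum-δ a

sum-const : ∀ k c → sum {k} (λ _ → c) ≡ k * c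
sum-const ℕ.zero c = refl
sum-const (suc k) c = cong (c +_) (sum-const k c)

sum-zero : ∀ {k} (g : Fin k → ℕ) → (∀ j → g j ≡ 0) → sum g ≡ 0
sum-zero {k} g g≡0 = trans (sum-cong-≗ g≡0) (sum-replicate-zero k)

sum-two-points : ∀ {k} (g : Fin k → ℕ) {a b : Fin k} → a ≢ b → g a ≡ 1 → g b ≡ 1 →
  (∀ j → j ≢ a → j ≢ b → g j ≡ 0) → sum g ≡ 2
sum-two-points g {a} {b} a≢b ga gb elsewhere = begin
  sum g                       ≡⟨ sum-cong-≗ decompose ⟩
  sum (λ j → δ a j + δ b j)   ≡⟨ ∑-distrib-+ (δ a) (δ b) ⟩
  sum (δ a) + sum (δ b)       ≡⟨ cong₂ _+_ (sum-δ a) (sum-δ b) ⟩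
  2                           ∎
  where
  decompose : ∀ j → g j ≡ δ a j + δ b j
  decompose j with j ≟ a | j ≟ b
  ... | yes refl | yes a≡b = ⊥-elim (a≢b a≡b)
  ... | yes refl | no _    = ga
  ... | no _     | yes refl = gb
  ... | no j≢a   | no j≢b   = elsewhere j j≢a j≢b

least : ∀ {k} {P : Fin k → Set} → Decidable P → ∃ P →
  Σ (Fin k) λ b → P b × (∀ j → j < b → ¬ P j)
least {suc k} P? (a , pa) with P? zero
... | yes p₀ = zero , p₀ , λ _ ()
least {suc k} P? (zero , pa)  | no ¬p₀ = ⊥-elim (¬p₀ pa)
least {suc k} P? (suc a , pa) | no ¬p₀ with least (P? ∘ suc) (a , pa)
... | b , pb , below = suc b , pb , λ { zero _ → ¬p₀ ; (suc j) (s≤s j<b) → below j j<b }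

greatest : ∀ {k} {P : Fin k → Set} → Decidable P → ∃ P →
  Σ (Fin k) λ b → P b × (∀ j → b < j → ¬ P j)
greatest {suc k} P? (a , pa) with any? (P? ∘ suc)
... | yes later with greatest (P? ∘ suc) later
...   | b , pb , above = suc b , pb , λ { (suc j) (s≤s b<j) → above j b<j }
greatest {suc k} P? (zero , pa)  | no none = zero , pa , λ { (suc j) _ pj → none (j , pj) }
greatest {suc k} P? (suc a , pa) | no none = ⊥-elim (none (a , pa))

module _ {k : ℕ} (f : Fin k → Bool) where

  OneLeftOf OneRightOf Around Inner Outer : Fin k → Set
  OneLeftOf j  = ∃ λ e → e < j × f e ≡ true
  OneRightOf j = ∃ λ e → j < e × f e ≡ true
  Around j     = OneLeftOf j × OneRightOf j
  Inner j      = f j ≡ true × Around j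
  Outer j      = f j ≡ true × ¬ Around j

  one-left? : ∀ j → Dec (OneLeftOf j)
  one-left? j = any? (λ e → (e <? j) ×-dec (f e ≟ᵇ true))

  one-right? : ∀ j → Dec (OneRightOf j)
  one-right? j = any? (λ e → (j <? e) ×-dec (f e ≟ᵇ true))

  around? : ∀ j → Dec (Around j)
  around? j = one-left? j ×-dec one-right? j

  inner? : ∀ j → Dec (Inner j)
  inner? j = (f j ≟ᵇ true) ×-dec around? j
  outer? : ∀ j → Dec (Outer j)
  outer? j = (f j ≟ᵇ true) ×-dec ¬? (around? j)

  ones-split : ∀ j → bit (f j) ≡ 𝟙 (inner? j) + 𝟙 (outer? j)
  ones-split j = bit-split (f j) (around? j)

  -- A row with at least two 1's has exactly two outer 1's, its leftmost
  -- and its rightmost 1.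
  outer-count : ∀ {a b} → a < b → f a ≡ true → f b ≡ true →
    sum (λ j → 𝟙 (outer? j)) ≡ 2
  outer-count {a} {b} a<b fa fb
    with least (λ j → f j ≟ᵇ true) (a , fa) | greatest (λ j → f j ≟ᵇ true) (b , fb)
  ... | l , fl , none-left | r , fr , none-right =
    sum-two-points (λ j → 𝟙 (outer? j)) (<⇒≢ l<r)
      (𝟙-yes (outer? l) (fl , λ { ((e , e<l , fe) , _) → none-left e e<l fe }))
      (𝟙-yes (outer? r) (fr , λ { (_ , (e , r<e , fe)) → none-right e r<e fe }))
      (λ j j≢l j≢r → 𝟙-no (outer? j) λ { (fj , ¬around) →
        ¬around ((l , ≤∧≢⇒< (l≤ fj) (j≢l ∘ sym) , fl) , (r , ≤∧≢⇒< (≤r fj) j≢r , fr)) })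
    where
    l≤ : ∀ {j} → f j ≡ true → l ≤ j
    l≤ fj = ≮⇒≥ (λ j<l → none-left _ j<l fj)
    ≤r : ∀ {j} → f j ≡ true → j ≤ r
    ≤r fj = ≮⇒≥ (λ r<j → none-right _ r<j fj)
    l<r : l < r
    l<r = ≤-<-trans (l≤ fa) (<-≤-trans a<b (≤r fb))

  row-count : ∀ {a b} → a < b → f a ≡ true → f b ≡ true →
    sum (λ j → bit (f j)) ≡ sum (λ j → 𝟙 (inner? j)) + 2
  row-count a<b fa fb = begin
    sum (λ j → bit (f j))                                  ≡⟨ sum-cong-≗ ones-split ⟩
    sum (λ j → 𝟙 (inner? j) + 𝟙 (outer? j))                ≡⟨ ∑-distrib-+ (𝟙 ∘ inner?) (𝟙 ∘ outer?) ⟩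
    sum (λ j → 𝟙 (inner? j)) + sum (λ j → 𝟙 (outer? j))    ≡⟨ cong (sum (𝟙 ∘ inner?) +_) (outer-count a<b fa fb) ⟩
    sum (λ j → 𝟙 (inner? j)) + 2                           ∎

Interior : ∀ {n} → Fin (suc n) → Set
Interior {n} c = zero {n} < c × c < fromℕ n

interior? : ∀ {n} (c : Fin (suc n)) → Dec (Interior c)
interior? {n} c = (zero {n} <? c) ×-dec (c <? fromℕ n)

interiorWeight : ∀ {n} → Fin (suc n) → ℕ
interiorWeight c = 2 * 𝟙 (interior? c)

weight-interior : ∀ {n} {c : Fin (suc n)} → Interior c → interiorWeight c ≡ 2
weight-interior {c = c} int = cong (2 *_) (𝟙-yes (interior? c) int)

weight-boundary : ∀ {n} {c : Fin (suc n)} → ¬ Interior c → interiorWeight c ≡ 0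
weight-boundary {c = c} ¬int = cong (2 *_) (𝟙-no (interior? c) ¬int)

inner⇒interior : ∀ {n} (f : Fin (suc n) → Bool) {c} → Inner f c → Interior c
inner⇒interior f (_ , (e , e<c , _) , (d , c<d , _)) = ≤-<-trans z≤n e<c , <-≤-trans c<d (≤fromℕ d)

interior-count : ∀ n → sum (interiorWeight {suc n}) ≡ n * 2
interior-count n = begin
  sum (interiorWeight {suc n})
    ≡⟨ sum-init-last (interiorWeight {suc n} ∘ suc) ⟩
  sum (interiorWeight {suc n} ∘ suc ∘ inject₁) + interiorWeight (fromℕ (suc n))
    ≡⟨ cong₂ _+_ (sum-cong-≗ (weight-interior ∘ interior-suc))
                 (weight-boundary {c = fromℕ (suc n)} λ { (_ , c<c) → <-irrefl refl c<c }) ⟩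
  sum {n} (λ _ → 2) + 0
    ≡⟨ trans (+-identityʳ _) (sum-const n 2) ⟩
  n * 2
    ∎
  where
  interior-suc : ∀ j → Interior {suc n} (suc (inject₁ j))
  interior-suc j = z<s , s<s (subst (toℕ (inject₁ j) ℕ.<_) (sym (toℕ-fromℕ n)) (inject₁ℕ< j))

module Maximal {m n} {A : Matrix m n} (maxA : MaximalAvoids312 A) where

  One : Fin m → Fin n → Set
  One i j = A i j ≡ true

  no312 : ∀ i₁ i₂ i₃ j₁ j₂ j₃ → i₁ < i₂ → i₂ < i₃ → j₁ < j₂ → j₂ < j₃ →
    One i₁ j₃ → One i₂ j₁ → One i₃ j₂ → ⊥
  no312 i₁ i₂ i₃ j₁ j₂ j₃ i₁<i₂ i₂<i₃ j₁<j₂ j₂<j₃ o₁ o₂ o₃ =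
    proj₁ maxA (i₁ , i₂ , i₃ , j₁ , j₂ , j₃ , i₁<i₂ , i₂<i₃ , j₁<j₂ , j₂<j₃ , o₁ , o₂ , o₃)

  -- The three ways a new 1 at (x , y) can complete a 312 with two 1's of A:
  -- as the top-right entry (the "3"), the middle-left entry (the "1") or the
  -- bottom-middle entry (the "2") of the pattern.
  data Completes3 (x : Fin m) (y : Fin n) : Set where
    completes3 : ∀ i₂ j₁ i₃ j₂ → x < i₂ → i₂ < i₃ → j₁ < j₂ → j₂ < y →
      One i₂ j₁ → One i₃ j₂ → Completes3 x y

  data Completes1 (x : Fin m) (y : Fin n) : Set where
    completes1 : ∀ i₁ j₃ i₃ j₂ → i₁ < x → x < i₃ → y < j₂ → j₂ < j₃ →
      One i₁ j₃ → One i₃ j₂ → Completes1 x y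

  data Completes2 (x : Fin m) (y : Fin n) : Set where
    completes2 : ∀ i₁ j₃ i₂ j₁ → i₁ < i₂ → i₂ < x → j₁ < y → y < j₃ →
      One i₁ j₃ → One i₂ j₁ → Completes2 x y

  set-entry : ∀ x y k l → setOne A x y k l ≡ true → (k ≡ x × l ≡ y) ⊎ One k l
  set-entry x y k l e with k ≟ x | l ≟ y
  ... | yes k≡x | yes l≡y = inj₁ (k≡x , l≡y)
  ... | yes _   | no _    = inj₂ e
  ... | no _    | _       = inj₂ e

  completion-role : ∀ x y → Contains312 (setOne A x y) →
    Completes3 x y ⊎ Completes1 x y ⊎ Completes2 x y
  completion-role x y (i₁ , i₂ , i₃ , j₁ , j₂ , j₃ , i₁<i₂ , i₂<i₃ , j₁<j₂ , j₂<j₃ , e₁ , e₂ , e₃)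
    with set-entry x y i₁ j₃ e₁ | set-entry x y i₂ j₁ e₂ | set-entry x y i₃ j₂ e₃
  ... | inj₁ (refl , refl) | inj₁ (i₂≡x , _) | _ = ⊥-elim (<⇒≢ i₁<i₂ (sym i₂≡x))
  ... | inj₁ (refl , refl) | inj₂ _ | inj₁ (i₃≡x , _) = ⊥-elim (<⇒≢ (<-trans i₁<i₂ i₂<i₃) (sym i₃≡x))
  ... | inj₁ (refl , refl) | inj₂ o₂ | inj₂ o₃ = inj₁ (completes3 i₂ j₁ i₃ j₂ i₁<i₂ i₂<i₃ j₁<j₂ j₂<j₃ o₂ o₃)
  ... | inj₂ _ | inj₁ (refl , refl) | inj₁ (i₃≡x , _) = ⊥-elim (<⇒≢ i₂<i₃ (sym i₃≡x))
  ... | inj₂ o₁ | inj₁ (refl , refl) | inj₂ o₃ = inj₂ (inj₁ (completes1 i₁ j₃ i₃ j₂ i₁<i₂ i₂<i₃ j₁<j₂ j₂<j₃ o₁ o₃))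
  ... | inj₂ o₁ | inj₂ o₂ | inj₁ (refl , refl) = inj₂ (inj₂ (completes2 i₁ j₃ i₂ j₁ i₁<i₂ i₂<i₃ j₁<j₂ j₂<j₃ o₁ o₂))
  ... | inj₂ o₁ | inj₂ o₂ | inj₂ o₃ = ⊥-elim (no312 i₁ i₂ i₃ j₁ j₂ j₃ i₁<i₂ i₂<i₃ j₁<j₂ j₂<j₃ o₁ o₂ o₃)

  forced-one : ∀ x y → ¬ Completes3 x y → ¬ Completes1 x y → ¬ Completes2 x y → One x y
  forced-one x y ¬3 ¬1 ¬2 with A x y in eq
  ... | true  = refl
  ... | false = ⊥-elim (proj₂ maxA x y eq (no-role ∘ completion-role x y))
    where
    no-role : Completes3 x y ⊎ Completes1 x y ⊎ Completes2 x y → ⊥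
    no-role (inj₁ c)        = ¬3 c
    no-role (inj₂ (inj₁ c)) = ¬1 c
    no-role (inj₂ (inj₂ c)) = ¬2 c

module Anchors {m n} {A : Matrix m (suc n)} (maxA : MaximalAvoids312 A) where
  open Maximal maxA

  AscentBelow : Fin m → Fin (suc n) → Set
  AscentBelow x s = Σ (Fin m) λ p → Σ (Fin (suc n)) λ q → Σ (Fin m) λ r →
    x < p × p < r × q < s × One p q × One r s

  DescentAcross : Fin m → Fin (suc n) → Set
  DescentAcross x s = Σ (Fin m) λ p → Σ (Fin (suc n)) λ q → Σ (Fin m) λ r →
    p < x × x < r × s < q × One p q × One r s

  one? : ∀ i j → Dec (One i j)
  one? i j = A i j ≟ᵇ true

  ascent-below? : ∀ x s → Dec (AscentBelow x s)
  ascent-below? x s = any? λ p → any? λ q → any? λ r →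
    (x <? p) ×-dec (p <? r) ×-dec (q <? s) ×-dec one? p q ×-dec one? r s

  descent-across? : ∀ x s → Dec (DescentAcross x s)
  descent-across? x s = any? λ p → any? λ q → any? λ r →
    (p <? x) ×-dec (x <? r) ×-dec (s <? q) ×-dec one? p q ×-dec one? r s

  -- Row x has a 1 in the leftmost column that carries an ascent below x, or
  -- in the last column if there is none.
  right-anchor : ∀ x → Σ (Fin (suc n)) λ ρ → One x ρ × (ρ ≡ fromℕ n ⊎ AscentBelow x ρ)
  right-anchor x with any? (ascent-below? x)
  ... | no none = fromℕ n , forced-one x (fromℕ n) ¬3 ¬1 ¬2 , inj₁ refl
    where
    ¬3 : ¬ Completes3 x (fromℕ n)
    ¬3 (completes3 p q r s x<p p<r q<s _ opq ors) = none (s , p , q , r , x<p , p<r , q<s , opq , ors)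
    ¬1 : ¬ Completes1 x (fromℕ n)
    ¬1 (completes1 _ _ _ j₂ _ _ last<j₂ _ _ _) = <⇒≱ last<j₂ (≤fromℕ j₂)
    ¬2 : ¬ Completes2 x (fromℕ n)
    ¬2 (completes2 _ j₃ _ _ _ _ _ last<j₃ _ _) = <⇒≱ last<j₃ (≤fromℕ j₃)
  ... | yes some with least (ascent-below? x) some
  ...   | ρ , asc@(p , q , r , x<p , p<r , q<ρ , opq , orρ) , earlier =
    ρ , forced-one x ρ ¬3 ¬1 ¬2 , inj₂ asc
    where
    ¬3 : ¬ Completes3 x ρ
    ¬3 (completes3 i₂ j₁ i₃ j₂ x<i₂ i₂<i₃ j₁<j₂ j₂<ρ o₂ o₃) =
      earlier j₂ j₂<ρ (i₂ , j₁ , i₃ , x<i₂ , i₂<i₃ , j₁<j₂ , o₂ , o₃)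
    ¬1 : ¬ Completes1 x ρ
    ¬1 (completes1 i₁ j₃ _ _ i₁<x _ ρ<j₂ j₂<j₃ o₁ _) =
      no312 i₁ p r q ρ j₃ (<-trans i₁<x x<p) p<r q<ρ (<-trans ρ<j₂ j₂<j₃) o₁ opq orρ
    ¬2 : ¬ Completes2 x ρ
    ¬2 (completes2 i₁ j₃ i₂ j₁ i₁<i₂ i₂<x j₁<ρ ρ<j₃ o₁ o₂) =
      no312 i₁ i₂ r j₁ ρ j₃ i₁<i₂ (<-trans i₂<x (<-trans x<p p<r)) j₁<ρ ρ<j₃ o₁ o₂ orρ

  -- Row x has a 1 in the rightmost column that carries a descent across x,
  -- or in the first column if there is none.
  left-anchor : ∀ x → Σ (Fin (suc n)) λ τ → One x τ × (τ ≡ zero ⊎ DescentAcross x τ)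
  left-anchor x with any? (descent-across? x)
  ... | no none = zero , forced-one x zero ¬3 ¬1 ¬2 , inj₁ refl
    where
    ¬3 : ¬ Completes3 x zero
    ¬3 (completes3 _ _ _ _ _ _ _ () _ _)
    ¬1 : ¬ Completes1 x zero
    ¬1 (completes1 p q r s p<x x<r _ s<q opq ors) = none (s , p , q , r , p<x , x<r , s<q , opq , ors)
    ¬2 : ¬ Completes2 x zero
    ¬2 (completes2 _ _ _ _ _ _ () _ _ _)
  ... | yes some with greatest (descent-across? x) some
  ...   | τ , desc@(p , q , r , p<x , x<r , τ<q , opq , orτ) , later =
    τ , forced-one x τ ¬3 ¬1 ¬2 , inj₂ desc
    where
    ¬3 : ¬ Completes3 x τ
    ¬3 (completes3 i₂ j₁ i₃ j₂ x<i₂ i₂<i₃ j₁<j₂ j₂<τ o₂ o₃) =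
      no312 p i₂ i₃ j₁ j₂ q (<-trans p<x x<i₂) i₂<i₃ j₁<j₂ (<-trans j₂<τ τ<q) opq o₂ o₃
    ¬1 : ¬ Completes1 x τ
    ¬1 (completes1 i₁ j₃ i₃ j₂ i₁<x x<i₃ τ<j₂ j₂<j₃ o₁ o₃) =
      later j₂ τ<j₂ (i₁ , j₃ , i₃ , i₁<x , x<i₃ , j₂<j₃ , o₁ , o₃)
    ¬2 : ¬ Completes2 x τ
    ¬2 (completes2 i₁ j₃ i₂ j₁ i₁<i₂ i₂<x j₁<τ τ<j₃ o₁ o₂) =
      no312 i₁ i₂ r j₁ τ j₃ i₁<i₂ (<-trans i₂<x x<r) j₁<τ τ<j₃ o₁ o₂ orτ

  two-ones : zero {n} < fromℕ n → ∀ x →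
    Σ (Fin (suc n)) λ a → Σ (Fin (suc n)) λ b → a < b × One x a × One x b
  two-ones first<last x with left-anchor x | right-anchor x
  ... | τ , oτ , inj₁ refl | ρ , oρ , inj₁ refl = τ , ρ , first<last , oτ , oρ
  ... | τ , oτ , inj₁ refl | ρ , oρ , inj₂ (_ , q , _ , _ , _ , q<ρ , _ , _) =
    τ , ρ , ≤-<-trans z≤n q<ρ , oτ , oρ
  ... | τ , oτ , inj₂ (_ , q , _ , _ , _ , τ<q , _ , _) | ρ , oρ , inj₁ refl =
    τ , ρ , <-≤-trans τ<q (≤fromℕ q) , oτ , oρ
  ... | τ , oτ , inj₂ (p , q , _ , p<x , _ , τ<q , opq , _)
      | ρ , oρ , inj₂ (p′ , q′ , r′ , x<p′ , p′<r′ , q′<ρ , op′q′ , or′ρ) with τ <? ρ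
  ...   | yes τ<ρ = τ , ρ , τ<ρ , oτ , oρ
  ...   | no τ≮ρ = ⊥-elim (no312 p p′ r′ q′ ρ q (<-trans p<x x<p′) p′<r′ q′<ρ
                             (≤-<-trans (≮⇒≥ τ≮ρ) τ<q) opq op′q′ or′ρ)

  one-left-of : ∀ x c → zero {n} < c → (∀ p → p < x → ¬ OneRightOf (A p) c) → OneLeftOf (A x) c
  one-left-of x c first<c none-above with left-anchor x
  ... | τ , oτ , inj₁ refl = τ , first<c , oτ
  ... | τ , oτ , inj₂ (p , q , _ , p<x , _ , τ<q , opq , _) with τ <? c
  ...   | yes τ<c = τ , τ<c , oτ
  ...   | no τ≮c = ⊥-elim (none-above p p<x (q , ≤-<-trans (≮⇒≥ τ≮c) τ<q , opq))

  one-right-of : ∀ x c t → t < x → OneRightOf (A t) c → OneRightOf (A x) c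
  one-right-of x c t t<x (d , c<d , otd) with right-anchor x
  ... | ρ , oρ , inj₁ refl = ρ , <-≤-trans c<d (≤fromℕ d) , oρ
  ... | ρ , oρ , inj₂ (p , q , r , x<p , p<r , q<ρ , opq , orρ) with c <? ρ
  ...   | yes c<ρ = ρ , c<ρ , oρ
  ...   | no c≮ρ = ⊥-elim (no312 t p r q ρ d (<-trans t<x x<p) p<r q<ρ
                             (≤-<-trans (≮⇒≥ c≮ρ) c<d) otd opq orρ)

  -- Let t be the topmost row with a 1 right of column c, and b the topmost
  -- row below t with a 1 left of c.  Then (t , c) and (b , c) are inner 1's,
  -- and any further inner 1 (i , c) would give the 312 at rows t < b < i.
  inner-column : ∀ c {p r} → p < r → OneRightOf (A p) c → OneLeftOf (A r) c →
    sum (λ i → 𝟙 (inner? (A i) c)) ≡ 2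
  inner-column c {p} {r} p<r right-p left-r@(_ , e′<c , _)
    with least (λ i → one-right? (A i) c) (p , right-p)
  ... | t , right-t@(d , c<d , otd) , none-above-t
    with least (λ i → (t <? i) ×-dec one-left? (A i) c)
               (r , ≤-<-trans (≮⇒≥ λ p<t → none-above-t p p<t right-p) p<r , left-r)
  ... | b , (t<b , left-b@(e , e<c , obe)) , none-between =
    sum-two-points (λ i → 𝟙 (inner? (A i) c)) (<⇒≢ t<b)
      (𝟙-yes (inner? (A t) c) (one-t , left-t , right-t))
      (𝟙-yes (inner? (A b) c) (one-b , left-b , one-right-of b c t t<b right-t))
      (λ i i≢t i≢b → 𝟙-no (inner? (A i) c) λ { (oic , left-i , right-i) →
        no312 t b i e c d t<b (below-b i≢t i≢b right-i left-i) e<c c<d otd obe oic })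
    where
    t≤ : ∀ {i} → OneRightOf (A i) c → t ≤ i
    t≤ right-i = ≮⇒≥ λ i<t → none-above-t _ i<t right-i

    below-b : ∀ {i} → i ≢ t → i ≢ b → OneRightOf (A i) c → OneLeftOf (A i) c → b < i
    below-b i≢t i≢b right-i left-i =
      ≤∧≢⇒< (≮⇒≥ λ i<b → none-between _ i<b (≤∧≢⇒< (t≤ right-i) (i≢t ∘ sym) , left-i)) (i≢b ∘ sym)

    left-t : OneLeftOf (A t) c
    left-t = one-left-of t c (≤-<-trans z≤n e′<c) none-above-t

    one-t : One t c
    one-t = forced-one t c ¬3 ¬1 ¬2
      where
      ¬3 : ¬ Completes3 t c
      ¬3 (completes3 i₂ j₁ i₃ j₂ t<i₂ i₂<i₃ j₁<j₂ j₂<c o₂ o₃) =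
        no312 t i₂ i₃ j₁ j₂ d t<i₂ i₂<i₃ j₁<j₂ (<-trans j₂<c c<d) otd o₂ o₃
      ¬1 : ¬ Completes1 t c
      ¬1 (completes1 i₁ j₃ _ _ i₁<t _ c<j₂ j₂<j₃ o₁ _) = none-above-t i₁ i₁<t (j₃ , <-trans c<j₂ j₂<j₃ , o₁)
      ¬2 : ¬ Completes2 t c
      ¬2 (completes2 i₁ j₃ i₂ _ i₁<i₂ i₂<t _ c<j₃ o₁ _) = none-above-t i₁ (<-trans i₁<i₂ i₂<t) (j₃ , c<j₃ , o₁)

    one-b : One b c
    one-b = forced-one b c ¬3 ¬1 ¬2
      where
      ¬3 : ¬ Completes3 b c
      ¬3 (completes3 i₂ j₁ i₃ j₂ b<i₂ i₂<i₃ j₁<j₂ j₂<c o₂ o₃) =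
        no312 t i₂ i₃ j₁ j₂ d (<-trans t<b b<i₂) i₂<i₃ j₁<j₂ (<-trans j₂<c c<d) otd o₂ o₃
      ¬1 : ¬ Completes1 b c
      ¬1 (completes1 i₁ j₃ i₃ j₂ i₁<b b<i₃ c<j₂ j₂<j₃ o₁ o₃) =
        no312 i₁ b i₃ e j₂ j₃ i₁<b b<i₃ (<-trans e<c c<j₂) j₂<j₃ o₁ obe o₃
      ¬2 : ¬ Completes2 b c
      ¬2 (completes2 i₁ j₃ i₂ j₁ i₁<i₂ i₂<b j₁<c c<j₃ o₁ o₂) =
        none-between i₂ i₂<b (≤-<-trans (t≤ (j₃ , c<j₃ , o₁)) i₁<i₂ , (j₁ , j₁<c , o₂))

  inner-count : ∀ {p r} → p < r → One p (fromℕ n) → One r zero →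
    ∀ c → sum (λ i → 𝟙 (inner? (A i) c)) ≡ interiorWeight c
  inner-count p<r op or c with interior? c
  ... | yes int@(first<c , c<last) =
    trans (inner-column c p<r (fromℕ n , c<last , op) (zero , first<c , or)) (sym (weight-interior int))
  ... | no ¬int = trans (sum-zero (λ i → 𝟙 (inner? (A i) c))
                          λ i → 𝟙-no (inner? (A i) c) (¬int ∘ inner⇒interior (A i)))
                        (sym (weight-boundary ¬int))

bottom-left-one : ∀ {m n} {A : Matrix (suc m) (suc n)} → MaximalAvoids312 A →
  A (fromℕ m) zero ≡ true
bottom-left-one {m} {n} maxA = forced-one (fromℕ m) zero ¬3 ¬1 ¬2
  where
  open Maximal maxA
  ¬3 : ¬ Completes3 (fromℕ m) zero
  ¬3 (completes3 i₂ _ _ _ last<i₂ _ _ _ _ _) = <⇒≱ last<i₂ (≤fromℕ i₂)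
  ¬1 : ¬ Completes1 (fromℕ m) zero
  ¬1 (completes1 _ _ i₃ _ _ last<i₃ _ _ _ _) = <⇒≱ last<i₃ (≤fromℕ i₃)
  ¬2 : ¬ Completes2 (fromℕ m) zero
  ¬2 (completes2 _ _ _ _ _ _ () _ _ _)

-- The penultimate row of a maximal matrix ends with a 1: only one row lies
-- below it, too few for the lower part of a 312.
penultimate : ∀ m → Fin (suc (suc m))
penultimate m = inject₁ (fromℕ m)

penultimate<last : ∀ m → penultimate m < fromℕ (suc m)
penultimate<last m = subst (ℕ._< suc (toℕ (fromℕ m))) (sym (toℕ-inject₁ (fromℕ m))) (n<1+n _)

penultimate-last-one : ∀ {m n} {A : Matrix (suc (suc m)) (suc n)} → MaximalAvoids312 A →
  A (penultimate m) (fromℕ n) ≡ true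
penultimate-last-one {m} {n} maxA = forced-one (penultimate m) (fromℕ n) ¬3 ¬1 ¬2
  where
  open Maximal maxA
  ¬3 : ¬ Completes3 (penultimate m) (fromℕ n)
  ¬3 (completes3 i₂ _ i₃ _ pen<i₂ i₂<i₃ _ _ _ _) =
    <⇒≱ (≤-<-trans (subst (λ k → suc k ℕ.≤ toℕ i₂) index pen<i₂) i₂<i₃) (ℕ.s≤s⁻¹ (toℕ<n i₃))
    where
    index : toℕ (penultimate m) ≡ m
    index = trans (toℕ-inject₁ (fromℕ m)) (toℕ-fromℕ m)
  ¬1 : ¬ Completes1 (penultimate m) (fromℕ n)
  ¬1 (completes1 _ _ _ j₂ _ _ last<j₂ _ _ _) = <⇒≱ last<j₂ (≤fromℕ j₂)
  ¬2 : ¬ Completes2 (penultimate m) (fromℕ n)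
  ¬2 (completes2 _ j₃ _ _ _ _ _ last<j₃ _ _) = <⇒≱ last<j₃ (≤fromℕ j₃)

ones-of-maximal : ∀ {m n} (A : Matrix (suc (suc m)) (suc (suc n))) → MaximalAvoids312 A →
  countOnes A ≡ n * 2 + suc (suc m) * 2
ones-of-maximal {m} {n} A maxA = begin
  sum (λ i → sum (λ j → bit (A i j)))
    ≡⟨ sum-cong-≗ row-total ⟩
  sum (λ i → sum (λ j → inner i j) + 2)
    ≡⟨ ∑-distrib-+ (λ i → sum (λ j → inner i j)) (λ _ → 2) ⟩
  sum (λ i → sum (λ j → inner i j)) + sum {M} (λ _ → 2)
    ≡⟨ cong₂ _+_ (∑-comm inner) (sum-const M 2) ⟩
  sum (λ j → sum (λ i → inner i j)) + M * 2
    ≡⟨ cong (_+ M * 2) (trans (sum-cong-≗ column-total) (interior-count n)) ⟩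
  n * 2 + M * 2
    ∎
  where
  open Anchors maxA
  M : ℕ
  M = suc (suc m)

  inner : Fin M → Fin (suc (suc n)) → ℕ
  inner i j = 𝟙 (inner? (A i) j)

  row-total : ∀ i → sum (λ j → bit (A i j)) ≡ sum (λ j → inner i j) + 2
  row-total i with two-ones z<s i
  ... | a , b , a<b , oa , ob = row-count (A i) a<b oa ob

  column-total : ∀ j → sum (λ i → inner i j) ≡ interiorWeight j
  column-total = inner-count (penultimate<last m) (penultimate-last-one maxA) (bottom-left-one maxA)

fin1-≮ : (a b : Fin 1) → ¬ a < b
fin1-≮ zero zero ()

single-row-full : ∀ {n} {A : Matrix 1 n} → MaximalAvoids312 A → ∀ i j → A i j ≡ true
single-row-full maxA i j = forced-one i j ¬3 ¬1 ¬2
  where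
  open Maximal maxA
  ¬3 : ¬ Completes3 i j
  ¬3 (completes3 i₂ _ _ _ i<i₂ _ _ _ _ _) = fin1-≮ i i₂ i<i₂
  ¬1 : ¬ Completes1 i j
  ¬1 (completes1 i₁ _ _ _ i₁<i _ _ _ _ _) = fin1-≮ i₁ i i₁<i
  ¬2 : ¬ Completes2 i j
  ¬2 (completes2 i₁ _ i₂ _ i₁<i₂ _ _ _ _ _) = fin1-≮ i₁ i₂ i₁<i₂

single-column-full : ∀ {m} {A : Matrix m 1} → MaximalAvoids312 A → ∀ i j → A i j ≡ true
single-column-full maxA i j = forced-one i j ¬3 ¬1 ¬2
  where
  open Maximal maxA
  ¬3 : ¬ Completes3 i j
  ¬3 (completes3 _ j₁ _ j₂ _ _ j₁<j₂ _ _ _) = fin1-≮ j₁ j₂ j₁<j₂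
  ¬1 : ¬ Completes1 i j
  ¬1 (completes1 _ j₃ _ j₂ _ _ _ j₂<j₃ _ _) = fin1-≮ j₂ j₃ j₂<j₃
  ¬2 : ¬ Completes2 i j
  ¬2 (completes2 _ j₃ _ _ _ _ _ j<j₃ _ _) = fin1-≮ j j₃ j<j₃

full-count : ∀ {m n} (A : Matrix m n) → (∀ i j → A i j ≡ true) → countOnes A ≡ m * n
full-count {m} {n} A full = begin
  sum (λ i → sum (λ j → bit (A i j)))   ≡⟨ sum-cong-≗ row-total ⟩
  sum {m} (λ _ → n)                     ≡⟨ sum-const m n ⟩
  m * n                                 ∎
  where
  row-total : ∀ i → sum (λ j → bit (A i j)) ≡ n
  row-total i = begin
    sum (λ j → bit (A i j))   ≡⟨ sum-cong-≗ (λ j → cong bit (full i j)) ⟩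
    sum {n} (λ _ → 1)         ≡⟨ sum-const n 1 ⟩
    n * 1                     ≡⟨ *-identityʳ n ⟩
    n                         ∎

corollary3p6 : (m n : ℕ) → m ≥ 1 → n ≥ 1 → (A B : Matrix m n) →
    MaximalAvoids312 A → MaximalAvoids312 B → countOnes A ≡ countOnes B
corollary3p6 1 n _ _ A B maxA maxB =
  trans (full-count A (single-row-full maxA)) (sym (full-count B (single-row-full maxB)))
corollary3p6 (suc (suc m)) 1 _ _ A B maxA maxB =
  trans (full-count A (single-column-full maxA)) (sym (full-count B (single-column-full maxB)))
corollary3p6 (suc (suc m)) (suc (suc n)) _ _ A B maxA maxB =
  trans (ones-of-maximal A maxA) (sym (ones-of-maximal B maxB))
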